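{- Let $\mathbf{v}\in\mathbb{R}^p$ and $\mathbf{w}\in\mathbb{R}^q$ be balanced vectors. If there exist vectors $\mathbf{x}\in\{ -1,0,1\}^p$ and $\mathbf{y}\in\{ -1,0,1\}^q$ with $\mathbf{v}\cdot\mathbf{x}=\mathbf{w}\cdot\mathbf{y}\neq0$, then the concatenated vector $(\mathbf{v},\mathbf{w})\in\mathbb{R}^{p+q}$ is balanced.
   Context: A vector $\mathbf{v}\in\mathbb{R}^p$ with $p\ge2$ is balanced if there exists a $(p-1)\times p$ matrix $A$ with all entries in $\{ -1,0,1\}$ such that the null space of $A$ equals $\mathrm{span}(\mathbf{v})$; by convention a vector in $\mathbb{R}^1$ is balanced iff it is non-zero. -}

module Defs where

open import Level using (Level; _⊔_; Lift) renaming (suc to lsuc)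
open import Algebra.Bundles using (CommutativeRing)
open import Data.Nat using (ℕ; zero; suc)
open import Data.Fin using (Fin)
import Data.Fin as Fin
open import Data.Product using (Σ; ∃; _×_; _,_)
open import Relation.Nullary using (¬_)
open import Function.Bundles using (_⇔_)
open import Data.Vec.Functional using (Vector)

-- A field (classical definition): a nontrivial commutative ring in which
-- every nonzero element has a multiplicative inverse.  ℝ is an instance.
record Field (c ℓ : Level) : Set (lsuc (c ⊔ ℓ)) where
  field
    commutativeRing : CommutativeRing c ℓ
  open CommutativeRing commutativeRing public
  field
    0≉1     : ¬ (0# ≈ 1#)
    inverse : ∀ x → ¬ (x ≈ 0#) → Σ Carrier λ y → x * y ≈ 1#

data Trit : Set where
  neg zer pos : Trit

module _ {c ℓ : Level} (F : Field c ℓ) where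
  open Field F

  ⟦_⟧ : Trit → Carrier
  ⟦ neg ⟧ = - 1#
  ⟦ zer ⟧ = 0#
  ⟦ pos ⟧ = 1#

  Σᶠ : ∀ {n} → (Fin n → Carrier) → Carrier
  Σᶠ {zero}  f = 0#
  Σᶠ {suc n} f = f Fin.zero + Σᶠ (λ i → f (Fin.suc i))

  _·ᵗ_ : ∀ {n} → Vector Carrier n → Vector Trit n → Carrier
  v ·ᵗ x = Σᶠ (λ i → v i * ⟦ x i ⟧)

  InNull : ∀ {m n} → (Fin m → Fin n → Trit) → Vector Carrier n → Set ℓ
  InNull A u = ∀ r → Σᶠ (λ j → ⟦ A r j ⟧ * u j) ≈ 0#

  InSpan : ∀ {n} → Vector Carrier n → Vector Carrier n → Set (c ⊔ ℓ)
  InSpan v u = Σ Carrier λ s → ∀ i → u i ≈ s * v i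

  -- balanced vectors in F^p (p ≥ 1, written p = suc n)
  Balanced : ∀ {n} → Vector Carrier (suc n) → Set (c ⊔ ℓ)
  Balanced {zero}  v = Lift c (¬ (v Fin.zero ≈ 0#))
  Balanced {suc n} v =
    Σ (Fin (suc n) → Fin (suc (suc n)) → Trit) λ A →
      ∀ (u : Vector Carrier (suc (suc n))) → InNull A u ⇔ InSpan v u

-- Given kernel matrices A for v and B for w, the block matrix
--
--   [ A   0  ]
--   [ x  −y  ]
--   [ 0   B  ]
--
-- has kernel spanned by the concatenation (v, w): the outer blocks force u = (s v, t w), and the middle
-- row then reads s (v · x) = t (w · y), so s = t because v · x = w · y ≠ 0.
module Submission where

open import Defs
open import Level using (Level; _⊔_; lift)
open import Data.Nat using (ℕ; zero; suc) renaming (_+_ to _ℕ+_)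
open import Data.Fin using (Fin; _↑ˡ_; _↑ʳ_; splitAt; join)
import Data.Fin as Fin
open import Data.Fin.Properties using (join-splitAt)
open import Data.Product using (Σ; _×_; _,_; proj₁; proj₂)
open import Data.Sum using ([_,_])
open import Relation.Nullary using (¬_)
open import Relation.Binary.PropositionalEquality using (cong; subst) renaming (sym to sym-≡)
open import Data.Vec.Functional using (Vector; _++_; _∷_; map; replicate; take; drop)
open import Data.Vec.Functional.Properties using (lookup-++ˡ; lookup-++ʳ)
open import Function.Base using (_∘_; id)
open import Function.Bundles using (_⇔_; mk⇔; Equivalence)
import Algebra.Properties.Ring as RingProperties
import Relation.Binary.Reasoning.Setoid as SetoidReasoning

-ᵗ_ : Trit → Trit
-ᵗ neg = pos
-ᵗ zer = zer
-ᵗ pos = neg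

↑ˡ-↑ʳ-elim : ∀ {p} m {n} (P : Fin (m ℕ+ n) → Set p) →
  (∀ i → P (i ↑ˡ n)) → (∀ j → P (m ↑ʳ j)) → ∀ k → P k
↑ˡ-↑ʳ-elim m {n} P left right k =
  subst P (join-splitAt m n k) ([_,_] {C = P ∘ join m n} left right (splitAt m k))

blockMatrix : ∀ {p q} → (Fin p → Fin (suc p) → Trit) → (Fin q → Fin (suc q) → Trit) →
  Vector Trit (suc p) → Vector Trit (suc q) → Fin (p ℕ+ suc q) → Vector Trit (suc p ℕ+ suc q)
blockMatrix {p} {q} A B x y =
  (λ r → A r ++ replicate (suc q) zer) ++ ((x ++ map -ᵗ_ y) ∷ (λ j → replicate (suc p) zer ++ B j))

module _ {c ℓ : Level} (F : Field c ℓ) where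
  open Field F
  open RingProperties ring
  open SetoidReasoning setoid

  Σᶠ-cong : ∀ {n} {f g : Fin n → Carrier} → (∀ i → f i ≈ g i) → Σᶠ F f ≈ Σᶠ F g
  Σᶠ-cong {zero}  f≈g = refl
  Σᶠ-cong {suc n} f≈g = +-cong (f≈g Fin.zero) (Σᶠ-cong (λ i → f≈g (Fin.suc i)))

  Σᶠ-zero : ∀ {n} {f : Fin n → Carrier} → (∀ i → f i ≈ 0#) → Σᶠ F f ≈ 0#
  Σᶠ-zero {zero}  f≈0 = refl
  Σᶠ-zero {suc n} f≈0 =
    trans (+-cong (f≈0 Fin.zero) (Σᶠ-zero (λ i → f≈0 (Fin.suc i)))) (+-identityˡ 0#)

  Σᶠ-*ˡ : ∀ {n} s (f : Fin n → Carrier) → Σᶠ F (λ i → s * f i) ≈ s * Σᶠ F f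
  Σᶠ-*ˡ {zero}  s f = sym (zeroʳ s)
  Σᶠ-*ˡ {suc n} s f =
    trans (+-congˡ (Σᶠ-*ˡ s (λ i → f (Fin.suc i)))) (sym (distribˡ s _ _))

  Σᶠ-neg : ∀ {n} (f : Fin n → Carrier) → Σᶠ F (λ i → - f i) ≈ - Σᶠ F f
  Σᶠ-neg {zero}  f = sym -0#≈0#
  Σᶠ-neg {suc n} f = trans (+-congˡ (Σᶠ-neg (λ i → f (Fin.suc i)))) (-‿+-comm _ _)

  Σᶠ-take-drop : ∀ m {n} (f : Fin (m ℕ+ n) → Carrier) →
    Σᶠ F f ≈ Σᶠ F (take m f) + Σᶠ F (drop m f)
  Σᶠ-take-drop zero    f = sym (+-identityˡ _)
  Σᶠ-take-drop (suc m) f =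
    trans (+-congˡ (Σᶠ-take-drop m (λ i → f (Fin.suc i)))) (sym (+-assoc _ _ _))

  *-cancelʳ-≉0 : ∀ {d s t} → ¬ (d ≈ 0#) → s * d ≈ t * d → s ≈ t
  *-cancelʳ-≉0 {d} {s} {t} d≉0 sd≈td = begin
    s                ≈⟨ *-identityʳ s ⟨
    s * 1#           ≈⟨ *-congˡ dd⁻¹≈1 ⟨
    s * (d * d⁻¹)    ≈⟨ *-assoc s d d⁻¹ ⟨
    (s * d) * d⁻¹    ≈⟨ *-congʳ sd≈td ⟩
    (t * d) * d⁻¹    ≈⟨ *-assoc t d d⁻¹ ⟩
    t * (d * d⁻¹)    ≈⟨ *-congˡ dd⁻¹≈1 ⟩
    t * 1#           ≈⟨ *-identityʳ t ⟩
    t                ∎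
    where
    d⁻¹ : Carrier
    d⁻¹ = proj₁ (inverse d d≉0)
    dd⁻¹≈1 : d * d⁻¹ ≈ 1#
    dd⁻¹≈1 = proj₂ (inverse d d≉0)

  ⟦-ᵗ⟧ : ∀ t → ⟦_⟧ F (-ᵗ t) ≈ - ⟦_⟧ F t
  ⟦-ᵗ⟧ neg = sym (-‿involutive 1#)
  ⟦-ᵗ⟧ zer = sym -0#≈0#
  ⟦-ᵗ⟧ pos = refl

  _ᵗ·_ : ∀ {n} → Vector Trit n → Vector Carrier n → Carrier
  a ᵗ· u = Σᶠ F (λ j → ⟦_⟧ F (a j) * u j)

  ᵗ·-++ : ∀ {m n} (a : Vector Trit m) (b : Vector Trit n) (u : Vector Carrier (m ℕ+ n)) →
    (a ++ b) ᵗ· u ≈ a ᵗ· take m u + b ᵗ· drop m u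
  ᵗ·-++ {m} {n} a b u = trans (Σᶠ-take-drop m _) (+-cong (Σᶠ-cong left) (Σᶠ-cong right))
    where
    left : ∀ i → ⟦_⟧ F ((a ++ b) (i ↑ˡ n)) * u (i ↑ˡ n) ≈ ⟦_⟧ F (a i) * u (i ↑ˡ n)
    left i = *-congʳ (reflexive (cong (⟦_⟧ F) (lookup-++ˡ a b i)))
    right : ∀ j → ⟦_⟧ F ((a ++ b) (m ↑ʳ j)) * u (m ↑ʳ j) ≈ ⟦_⟧ F (b j) * u (m ↑ʳ j)
    right j = *-congʳ (reflexive (cong (⟦_⟧ F) (lookup-++ʳ a b j)))

  replicate-zer-ᵗ· : ∀ {n} (u : Vector Carrier n) → replicate n zer ᵗ· u ≈ 0#
  replicate-zer-ᵗ· u = Σᶠ-zero (λ j → zeroˡ (u j))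

  map-ᵗ-ᵗ· : ∀ {n} (a : Vector Trit n) (u : Vector Carrier n) → map -ᵗ_ a ᵗ· u ≈ - (a ᵗ· u)
  map-ᵗ-ᵗ· a u = trans (Σᶠ-cong negate) (Σᶠ-neg (λ j → ⟦_⟧ F (a j) * u j))
    where
    negate : ∀ j → ⟦_⟧ F (-ᵗ a j) * u j ≈ - (⟦_⟧ F (a j) * u j)
    negate j = trans (*-congʳ (⟦-ᵗ⟧ (a j))) (sym (-‿distribˡ-* _ _))

  ᵗ·-scaled : ∀ {n} (a : Vector Trit n) {s} {v u : Vector Carrier n} →
    (∀ i → u i ≈ s * v i) → a ᵗ· u ≈ s * _·ᵗ_ F v a
  ᵗ·-scaled a {s} {v} {u} u≈sv = trans (Σᶠ-cong pointwise) (Σᶠ-*ˡ s (λ i → v i * ⟦_⟧ F (a i)))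
    where
    pointwise : ∀ i → ⟦_⟧ F (a i) * u i ≈ s * (v i * ⟦_⟧ F (a i))
    pointwise i = begin
      ⟦_⟧ F (a i) * u i          ≈⟨ *-congˡ (u≈sv i) ⟩
      ⟦_⟧ F (a i) * (s * v i)    ≈⟨ *-comm _ _ ⟩
      (s * v i) * ⟦_⟧ F (a i)    ≈⟨ *-assoc s (v i) _ ⟩
      s * (v i * ⟦_⟧ F (a i))    ∎

  ++-zer-ᵗ· : ∀ {m n} (a : Vector Trit m) (u : Vector Carrier (m ℕ+ n)) →
    (a ++ replicate n zer) ᵗ· u ≈ a ᵗ· take m u
  ++-zer-ᵗ· {m} a u =
    trans (ᵗ·-++ a _ u) (trans (+-congˡ (replicate-zer-ᵗ· (drop m u))) (+-identityʳ _))

  zer-++-ᵗ· : ∀ {m n} (b : Vector Trit n) (u : Vector Carrier (m ℕ+ n)) →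
    (replicate m zer ++ b) ᵗ· u ≈ b ᵗ· drop m u
  zer-++-ᵗ· {m} b u =
    trans (ᵗ·-++ _ b u) (trans (+-congʳ (replicate-zer-ᵗ· (take m u))) (+-identityˡ _))

  ++-map-ᵗ-ᵗ· : ∀ {m n} (a : Vector Trit m) (b : Vector Trit n) (u : Vector Carrier (m ℕ+ n)) →
    (a ++ map -ᵗ_ b) ᵗ· u ≈ a ᵗ· take m u - b ᵗ· drop m u
  ++-map-ᵗ-ᵗ· {m} a b u = trans (ᵗ·-++ a _ u) (+-congˡ (map-ᵗ-ᵗ· b (drop m u)))

  IsKernelMatrix : ∀ {m n} → (Fin m → Fin n → Trit) → Vector Carrier n → Set (c ⊔ ℓ)
  IsKernelMatrix A v = ∀ u → InNull F A u ⇔ InSpan F v u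

  KernelMatrix : ∀ {n} → Vector Carrier (suc n) → Set (c ⊔ ℓ)
  KernelMatrix {n} v = Σ (Fin n → Fin (suc n) → Trit) λ A → IsKernelMatrix A v

  -- For p = 1 the kernel matrix is the empty 0 × 1 matrix, whose kernel is span(v) iff v ≠ 0.
  balanced⇔kernelMatrix : ∀ {n} (v : Vector Carrier (suc n)) → Balanced F v ⇔ KernelMatrix v
  balanced⇔kernelMatrix {zero}  v = mk⇔ emptyMatrix nonzero
    where
    v₀ : Carrier
    v₀ = v Fin.zero

    emptyMatrix : Balanced F v → KernelMatrix v
    emptyMatrix (lift v₀≉0) = (λ ()) , λ u → mk⇔ (λ _ → spanned u) (λ _ ())
      where
      v₀⁻¹ : Carrier
      v₀⁻¹ = proj₁ (inverse v₀ v₀≉0)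
      v₀v₀⁻¹≈1 : v₀ * v₀⁻¹ ≈ 1#
      v₀v₀⁻¹≈1 = proj₂ (inverse v₀ v₀≉0)

      spanned : ∀ u → InSpan F v u
      spanned u = u Fin.zero * v₀⁻¹ , λ { Fin.zero → begin
        u Fin.zero                   ≈⟨ *-identityʳ _ ⟨
        u Fin.zero * 1#              ≈⟨ *-congˡ v₀v₀⁻¹≈1 ⟨
        u Fin.zero * (v₀ * v₀⁻¹)     ≈⟨ *-congˡ (*-comm v₀ v₀⁻¹) ⟩
        u Fin.zero * (v₀⁻¹ * v₀)     ≈⟨ *-assoc _ _ _ ⟨
        (u Fin.zero * v₀⁻¹) * v₀     ∎ }

    nonzero : KernelMatrix v → Balanced F v
    nonzero (_ , kerA) = lift λ v₀≈0 →
      let (s , 1≈sv) = Equivalence.to (kerA (λ _ → 1#)) (λ ())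
      in 0≉1 (sym (begin
        1#        ≈⟨ 1≈sv Fin.zero ⟩
        s * v₀    ≈⟨ *-congˡ v₀≈0 ⟩
        s * 0#    ≈⟨ zeroʳ s ⟩
        0#        ∎))
  balanced⇔kernelMatrix {suc n} v = mk⇔ id id

  InSpan-++ : ∀ {m n} (v : Vector Carrier m) (w : Vector Carrier n) (u : Vector Carrier (m ℕ+ n)) →
    InSpan F (v ++ w) u ⇔
    Σ Carrier λ s → (∀ i → take m u i ≈ s * v i) × (∀ j → drop m u j ≈ s * w j)
  InSpan-++ {m} {n} v w u = mk⇔
    (λ (s , u≈s[v++w]) → s
      , (λ i → trans (u≈s[v++w] (i ↑ˡ n)) (*-congˡ (reflexive (lookup-++ˡ v w i))))
      , (λ j → trans (u≈s[v++w] (m ↑ʳ j)) (*-congˡ (reflexive (lookup-++ʳ v w j)))))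
    (λ (s , u≈sv , u≈sw) → s , ↑ˡ-↑ʳ-elim m (λ k → u k ≈ s * (v ++ w) k)
      (λ i → trans (u≈sv i) (*-congˡ (reflexive (sym-≡ (lookup-++ˡ v w i)))))
      (λ j → trans (u≈sw j) (*-congˡ (reflexive (sym-≡ (lookup-++ʳ v w j))))))

  InNull-blockMatrix : ∀ {p q} (A : Fin p → Fin (suc p) → Trit) (B : Fin q → Fin (suc q) → Trit)
    (x : Vector Trit (suc p)) (y : Vector Trit (suc q)) (u : Vector Carrier (suc p ℕ+ suc q)) →
    InNull F (blockMatrix A B x y) u ⇔
    (InNull F A (take (suc p) u) × x ᵗ· take (suc p) u ≈ y ᵗ· drop (suc p) u × InNull F B (drop (suc p) u))
  InNull-blockMatrix {p} {q} A B x y u = mk⇔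
    (λ Mu≈0 → (λ r → trans (sym (rowA r)) (Mu≈0 (r ↑ˡ suc q)))
      , x∙y⁻¹≈ε⇒x≈y _ _ (trans (sym rowXY) (Mu≈0 (p ↑ʳ Fin.zero)))
      , (λ j → trans (sym (rowB j)) (Mu≈0 (p ↑ʳ Fin.suc j))))
    (λ (Aa≈0 , xa≈yb , Bb≈0) → ↑ˡ-↑ʳ-elim p (λ r → M r ᵗ· u ≈ 0#)
      (λ r → trans (rowA r) (Aa≈0 r))
      λ { Fin.zero    → trans rowXY (x≈y⇒x∙y⁻¹≈ε xa≈yb)
        ; (Fin.suc j) → trans (rowB j) (Bb≈0 j) })
    where
    M : Fin (p ℕ+ suc q) → Vector Trit (suc p ℕ+ suc q)
    M = blockMatrix A B x y
    upper : Fin p → Vector Trit (suc p ℕ+ suc q)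
    upper r = A r ++ replicate (suc q) zer
    a : Vector Carrier (suc p)
    a = take (suc p) u
    b : Vector Carrier (suc q)
    b = drop (suc p) u

    rowA : ∀ r → M (r ↑ˡ suc q) ᵗ· u ≈ A r ᵗ· a
    rowA r = trans (reflexive (cong (_ᵗ· u) (lookup-++ˡ upper _ r))) (++-zer-ᵗ· (A r) u)

    rowXY : M (p ↑ʳ Fin.zero) ᵗ· u ≈ x ᵗ· a - y ᵗ· b
    rowXY = trans (reflexive (cong (_ᵗ· u) (lookup-++ʳ upper _ Fin.zero))) (++-map-ᵗ-ᵗ· x y u)

    rowB : ∀ j → M (p ↑ʳ Fin.suc j) ᵗ· u ≈ B j ᵗ· b
    rowB j = trans (reflexive (cong (_ᵗ· u) (lookup-++ʳ upper _ (Fin.suc j)))) (zer-++-ᵗ· {suc p} (B j) u)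

  blockMatrix-isKernelMatrix : ∀ {p q} {A : Fin p → Fin (suc p) → Trit} {B : Fin q → Fin (suc q) → Trit}
    {v : Vector Carrier (suc p)} {w : Vector Carrier (suc q)} →
    IsKernelMatrix A v → IsKernelMatrix B w →
    (x : Vector Trit (suc p)) (y : Vector Trit (suc q)) →
    _·ᵗ_ F v x ≈ _·ᵗ_ F w y → ¬ (_·ᵗ_ F v x ≈ 0#) →
    IsKernelMatrix (blockMatrix A B x y) (v ++ w)
  blockMatrix-isKernelMatrix {p} {q} {A} {B} {v} {w} kerA kerB x y v·x≈w·y v·x≉0 u =
    mk⇔ null⇒span span⇒null
    where
    a : Vector Carrier (suc p)
    a = take (suc p) u
    b : Vector Carrier (suc q)
    b = drop (suc p) u

    null⇒span : InNull F (blockMatrix A B x y) u → InSpan F (v ++ w) u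
    null⇒span Mu≈0 =
      let (Aa≈0 , xa≈yb , Bb≈0) = Equivalence.to (InNull-blockMatrix A B x y u) Mu≈0
          (s , a≈sv) = Equivalence.to (kerA a) Aa≈0
          (t , b≈tw) = Equivalence.to (kerB b) Bb≈0
          s≈t = *-cancelʳ-≉0 v·x≉0 (begin
            s * _·ᵗ_ F v x    ≈⟨ ᵗ·-scaled x a≈sv ⟨
            x ᵗ· a            ≈⟨ xa≈yb ⟩
            y ᵗ· b            ≈⟨ ᵗ·-scaled y b≈tw ⟩
            t * _·ᵗ_ F w y    ≈⟨ *-congˡ v·x≈w·y ⟨
            t * _·ᵗ_ F v x    ∎)
      in Equivalence.from (InSpan-++ v w u) (s , a≈sv , λ j → trans (b≈tw j) (*-congʳ (sym s≈t)))

    span⇒null : InSpan F (v ++ w) u → InNull F (blockMatrix A B x y) u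
    span⇒null u∈span =
      let (s , a≈sv , b≈sw) = Equivalence.to (InSpan-++ v w u) u∈span
          xa≈yb = begin
            x ᵗ· a            ≈⟨ ᵗ·-scaled x a≈sv ⟩
            s * _·ᵗ_ F v x    ≈⟨ *-congˡ v·x≈w·y ⟩
            s * _·ᵗ_ F w y    ≈⟨ ᵗ·-scaled y b≈sw ⟨
            y ᵗ· b            ∎
      in Equivalence.from (InNull-blockMatrix A B x y u)
           (Equivalence.from (kerA a) (s , a≈sv) , xa≈yb , Equivalence.from (kerB b) (s , b≈sw))

proposition3p4 : ∀ {c ℓ : Level} (F : Field c ℓ) (p q : ℕ)
    (v : Vector (Field.Carrier F) (suc p)) (w : Vector (Field.Carrier F) (suc q)) →
    Balanced F v → Balanced F w →
    (x : Vector Trit (suc p)) (y : Vector Trit (suc q)) →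
    Field._≈_ F (_·ᵗ_ F v x) (_·ᵗ_ F w y) →
    ¬ (Field._≈_ F (_·ᵗ_ F v x) (Field.0# F)) →
    Balanced F (v ++ w)
proposition3p4 F p q v w v-balanced w-balanced x y v·x≈w·y v·x≉0 =
  let (A , kerA) = Equivalence.to (balanced⇔kernelMatrix F v) v-balanced
      (B , kerB) = Equivalence.to (balanced⇔kernelMatrix F w) w-balanced
  in Equivalence.from (balanced⇔kernelMatrix F (v ++ w))
       (blockMatrix A B x y , blockMatrix-isKernelMatrix F kerA kerB x y v·x≈w·y v·x≉0)
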